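{- Let $f:\{0,1\}^n\to\{0,1\}$ be a conjunction, and let $\mathrm{Samp}^*(f)$ be an oracle which returns independent samples from some distribution $\mathcal{D}$ supported on $F=f^{ -1}(1)$ (not necessarily uniform). Then the algorithm Conj-Test, run with $\mathrm{MQ}(f)$ and $\mathrm{Samp}^*(f)$ in place of the sampling oracle, accepts $f$ with probability $1$.
   Context: A conjunction is an AND of literals (variables or negated variables). $\oplus$ is coordinatewise XOR and $y\preceq x$ means $y_i\le x_i$ for all $i$. Conj-Test (with parameter $\varepsilon>0$ and absolute constants $c_1,c_2$), given a membership oracle for $f$ and a sampling oracle $S$: draw one sample $s$ from $S$, and let $f_s(x):=f(x\oplus s)$ (membership queries to $f_s$ are answered via $\mathrm{MQ}(f)$, and samples for $f_s$ are obtained by drawing $z$ from $S$ and returning $z\oplus s$). Then run on $f_s$: Phase 1: repeat $c_1/\varepsilon$ times: draw samples $x,y$; if $f_s(x\oplus y)=0$, halt and reject. Phase 2: repeat $c_2$ times: draw a sample $x$, draw $y$ uniformly from $\{y:y\preceq x\}$, draw a sample $u$; if $f_s(y\oplus u)=0$, halt and reject. Finally, accept. -}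

module Defs where

open import Data.Bool using (Bool; true; false; not; _∧_; _xor_; _≟_)
import Data.Bool as B
open import Data.Nat using (ℕ)
open import Data.Fin using (Fin)
open import Data.List using (List; []; _∷_)
open import Data.Vec using (Vec; []; _∷_; zipWith; lookup)
open import Data.Product using (_×_; _,_)
open import Data.Vec.Relation.Binary.Pointwise.Inductive using (Pointwise)
open import Data.Vec.Relation.Unary.All using (All)
open import Relation.Binary.PropositionalEquality using (_≡_)

Point : ℕ → Set
Point n = Vec Bool n

_⊕_ : ∀ {n} → Point n → Point n → Point n
_⊕_ = zipWith _xor_

_⪯_ : ∀ {n} → Point n → Point n → Set
y ⪯ x = Pointwise B._≤_ y x

record Literal (n : ℕ) : Set where
  constructor lit
  field
    var      : Fin n
    polarity : Bool

evalLit : ∀ {n} → Literal n → Point n → Bool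
evalLit (lit i true)  x = lookup x i
evalLit (lit i false) x = not (lookup x i)

Conjunction : ℕ → Set
Conjunction n = List (Literal n)

evalConj : ∀ {n} → Conjunction n → Point n → Bool
evalConj []       x = true
evalConj (l ∷ ls) x = evalLit l x ∧ evalConj ls x

InF : ∀ {n} → (Point n → Bool) → Point n → Set
InF f x = f x ≡ true

-- Conj-Test as a deterministic function of its random choices.
-- f     : membership oracle MQ(f)
-- s     : the initial sample drawn from the sampling oracle
-- Phase 1 iterations: pairs (z₁ , z₂) of raw oracle samples; the samples for
--   f_s are x = z₁ ⊕ s, y = z₂ ⊕ s, and the query is f_s(x ⊕ y) = f((x ⊕ y) ⊕ s).
-- Phase 2 iterations: triples (z , y , w): z, w raw oracle samples, giving
--   samples x = z ⊕ s and u = w ⊕ s for f_s, and y the point drawn from {y ⪯ x};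
--   the query is f_s(y ⊕ u) = f((y ⊕ u) ⊕ s).
fShift : ∀ {n} → (Point n → Bool) → Point n → Point n → Bool
fShift f s x = f (x ⊕ s)

phase1 : ∀ {n m} → (Point n → Bool) → Point n → Vec (Point n × Point n) m → Bool
phase1 f s []               = true
phase1 f s ((z₁ , z₂) ∷ rs) =
  fShift f s ((z₁ ⊕ s) ⊕ (z₂ ⊕ s)) ∧ phase1 f s rs

phase2 : ∀ {n m} → (Point n → Bool) → Point n → Vec (Point n × Point n × Point n) m → Bool
phase2 f s []                 = true
phase2 f s ((z , y , w) ∷ rs) =
  fShift f s (y ⊕ (w ⊕ s)) ∧ phase2 f s rs

conjTest : ∀ {n m₁ m₂} → (Point n → Bool) → Point n →
           Vec (Point n × Point n) m₁ → Vec (Point n × Point n × Point n) m₂ → Bool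
conjTest f s r₁ r₂ = phase1 f s r₁ ∧ phase2 f s r₂

-- A run (tuple of random choices) has positive probability iff every oracle
-- sample lies in the support of 𝒟 (here: a subset Supp of F) and each phase-2
-- y satisfies y ⪯ x = z ⊕ s.
ValidPhase1 : ∀ {n m} → (Point n → Set) → Vec (Point n × Point n) m → Set
ValidPhase1 Supp = All (λ { (z₁ , z₂) → Supp z₁ × Supp z₂ })

ValidPhase2 : ∀ {n m} → (Point n → Set) → Point n → Vec (Point n × Point n × Point n) m → Set
ValidPhase2 Supp s = All (λ { (z , y , w) → Supp z × (y ⪯ (z ⊕ s)) × Supp w })

-- A conjunction depends only on its variables, and all of F takes the same prescribed values
-- there. The shift s and every sample lie in F, so the shifted samples x, u of f_s vanish on
-- those variables, and so does any y ⪯ x. Each query point is (a ⊕ b) ⊕ s with a, b among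
-- these vanishing points, hence agrees with s on the variables, and f returns 1 on it.
module Submission where

open import Defs
open import Data.Nat using (ℕ)
open import Data.Bool using (true; false; _∧_; _xor_)
import Data.Bool as B
open import Data.Bool.Properties using (xor-same)
open import Data.Fin using (Fin)
open import Data.List using ([]; _∷_)
open import Data.List.Relation.Unary.All as All using (All; []; _∷_)
open import Data.Vec using (Vec; []; _∷_; lookup)
open import Data.Vec.Properties using (lookup-zipWith)
import Data.Vec.Relation.Binary.Pointwise.Inductive as Pointwise
import Data.Vec.Relation.Unary.All as VecAll
open import Data.Product using (_×_; _,_)
open import Relation.Binary.PropositionalEquality
  using (_≡_; refl; sym; trans; subst; cong; cong₂; module ≡-Reasoning)

open Literal

variable
  n : ℕ

lookup-⊕ : (a b : Point n) (i : Fin n) → lookup (a ⊕ b) i ≡ lookup a i xor lookup b i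
lookup-⊕ a b i = lookup-zipWith _xor_ i a b

lookup-⊕-self : (a b : Point n) (i : Fin n) → lookup a i ≡ lookup b i → lookup (a ⊕ b) i ≡ false
lookup-⊕-self a b i aᵢ≡bᵢ = begin
  lookup (a ⊕ b) i              ≡⟨ lookup-⊕ a b i ⟩
  lookup a i xor lookup b i     ≡⟨ cong (_xor lookup b i) aᵢ≡bᵢ ⟩
  lookup b i xor lookup b i     ≡⟨ xor-same (lookup b i) ⟩
  false                         ∎
  where open ≡-Reasoning

lookup-⊕-falseˡ : (a b : Point n) (i : Fin n) → lookup a i ≡ false → lookup (a ⊕ b) i ≡ lookup b i
lookup-⊕-falseˡ a b i aᵢ≡false = trans (lookup-⊕ a b i) (cong (_xor lookup b i) aᵢ≡false)

lookup-⊕⊕-cancel : (a b s : Point n) (i : Fin n) →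
                   lookup a i ≡ false → lookup b i ≡ false → lookup ((a ⊕ b) ⊕ s) i ≡ lookup s i
lookup-⊕⊕-cancel a b s i aᵢ≡false bᵢ≡false =
  lookup-⊕-falseˡ (a ⊕ b) s i (trans (lookup-⊕-falseˡ a b i aᵢ≡false) bᵢ≡false)

≤false⇒≡false : ∀ {b} → b B.≤ false → b ≡ false
≤false⇒≡false B.b≤b = refl

AgreeOn : Conjunction n → Point n → Point n → Set
AgreeOn c x y = All (λ l → lookup x (var l) ≡ lookup y (var l)) c

evalLit-cong : (l : Literal n) {x y : Point n} →
               lookup x (var l) ≡ lookup y (var l) → evalLit l x ≡ evalLit l y
evalLit-cong (lit i true)  xᵢ≡yᵢ = xᵢ≡yᵢ
evalLit-cong (lit i false) xᵢ≡yᵢ = cong B.not xᵢ≡yᵢ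

evalConj-cong : (c : Conjunction n) {x y : Point n} → AgreeOn c x y → evalConj c x ≡ evalConj c y
evalConj-cong []      []            = refl
evalConj-cong (l ∷ c) (xₗ≡yₗ ∷ agr) = cong₂ _∧_ (evalLit-cong l xₗ≡yₗ) (evalConj-cong c agr)

evalLit≡true⇒lookup≡polarity : (l : Literal n) (x : Point n) →
                               evalLit l x ≡ true → lookup x (var l) ≡ polarity l
evalLit≡true⇒lookup≡polarity (lit i true)  x xᵢ≡true = xᵢ≡true
evalLit≡true⇒lookup≡polarity (lit i false) x notxᵢ≡true with lookup x i
... | false = refl

evalConj≡true⇒lookup≡polarity : (c : Conjunction n) (x : Point n) → evalConj c x ≡ true →
                                All (λ l → lookup x (var l) ≡ polarity l) c
evalConj≡true⇒lookup≡polarity []      x _ = []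
evalConj≡true⇒lookup≡polarity (l ∷ c) x sat with evalLit l x in eq
... | true = evalLit≡true⇒lookup≡polarity l x eq ∷ evalConj≡true⇒lookup≡polarity c x sat

satisfying-agree : (c : Conjunction n) {x y : Point n} →
                   evalConj c x ≡ true → evalConj c y ≡ true → AgreeOn c x y
satisfying-agree c {x} {y} satx saty =
  All.zipWith (λ (xₗ≡p , yₗ≡p) → trans xₗ≡p (sym yₗ≡p))
              (evalConj≡true⇒lookup≡polarity c x satx , evalConj≡true⇒lookup≡polarity c y saty)

phase1-query-agrees : (c : Conjunction n) (z₁ z₂ s : Point n) →
                      AgreeOn c z₁ s → AgreeOn c z₂ s → AgreeOn c (((z₁ ⊕ s) ⊕ (z₂ ⊕ s)) ⊕ s) s
phase1-query-agrees c z₁ z₂ s agr₁ agr₂ =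
  All.zipWith (λ {l} (z₁ₗ≡sₗ , z₂ₗ≡sₗ) →
                 lookup-⊕⊕-cancel (z₁ ⊕ s) (z₂ ⊕ s) s (var l)
                   (lookup-⊕-self z₁ s (var l) z₁ₗ≡sₗ) (lookup-⊕-self z₂ s (var l) z₂ₗ≡sₗ))
              (agr₁ , agr₂)

phase2-query-agrees : (c : Conjunction n) (z y w s : Point n) → y ⪯ (z ⊕ s) →
                      AgreeOn c z s → AgreeOn c w s → AgreeOn c ((y ⊕ (w ⊕ s)) ⊕ s) s
phase2-query-agrees c z y w s y⪯z⊕s agrz agrw =
  All.zipWith (λ {l} (zₗ≡sₗ , wₗ≡sₗ) →
                 lookup-⊕⊕-cancel y (w ⊕ s) s (var l)
                   (≤false⇒≡false (subst (lookup y (var l) B.≤_)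
                                          (lookup-⊕-self z s (var l) zₗ≡sₗ)
                                          (Pointwise.lookup y⪯z⊕s (var l))))
                   (lookup-⊕-self w s (var l) wₗ≡sₗ))
              (agrz , agrw)

module _ (c : Conjunction n) {Supp : Point n → Set}
         (Supp⊆F : ∀ x → Supp x → InF (evalConj c) x) {s : Point n} (s∈Supp : Supp s) where

  agrees-with-shift : ∀ {x} → Supp x → AgreeOn c x s
  agrees-with-shift x∈Supp = satisfying-agree c (Supp⊆F _ x∈Supp) (Supp⊆F s s∈Supp)

  accepted-if-agrees : ∀ {q} → AgreeOn c q s → evalConj c q ≡ true
  accepted-if-agrees agr = trans (evalConj-cong c agr) (Supp⊆F s s∈Supp)

  phase1-accepts : ∀ {m} (r : Vec (Point n × Point n) m) → ValidPhase1 Supp r →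
                   phase1 (evalConj c) s r ≡ true
  phase1-accepts []              VecAll.[]                 = refl
  phase1-accepts ((z₁ , z₂) ∷ r) ((z₁∈ , z₂∈) VecAll.∷ v) =
    cong₂ _∧_ (accepted-if-agrees
                (phase1-query-agrees c z₁ z₂ s (agrees-with-shift z₁∈) (agrees-with-shift z₂∈)))
              (phase1-accepts r v)

  phase2-accepts : ∀ {m} (r : Vec (Point n × Point n × Point n) m) → ValidPhase2 Supp s r →
                   phase2 (evalConj c) s r ≡ true
  phase2-accepts []                VecAll.[]                      = refl
  phase2-accepts ((z , y , w) ∷ r) ((z∈ , y⪯x , w∈) VecAll.∷ v) =
    cong₂ _∧_ (accepted-if-agrees
                (phase2-query-agrees c z y w s y⪯x (agrees-with-shift z∈) (agrees-with-shift w∈)))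
              (phase2-accepts r v)

theorem3p18 : ∀ {n} (c : Conjunction n) (Supp : Point n → Set)
    → (∀ x → Supp x → InF (evalConj c) x)
    → (m₁ m₂ : ℕ) (s : Point n)
    (r₁ : Vec (Point n × Point n) m₁)
    (r₂ : Vec (Point n × Point n × Point n) m₂)
    → Supp s → ValidPhase1 Supp r₁ → ValidPhase2 Supp s r₂
    → conjTest (evalConj c) s r₁ r₂ ≡ true
theorem3p18 c Supp Supp⊆F m₁ m₂ s r₁ r₂ s∈Supp v₁ v₂ =
  cong₂ _∧_ (phase1-accepts c Supp⊆F s∈Supp r₁ v₁) (phase2-accepts c Supp⊆F s∈Supp r₂ v₂)
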